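{- Let $G$ be a singular simple graph whose set $CV$ of core vertices is independent, and label its vertices so that the vertices of $CV$ come first, then those of $N(CV)$, then those of $CFV_R$, so that the adjacency matrix has the block form $$\mathbf{A}=\begin{pmatrix}\mathbf{0}&\mathbf{Q}&\mathbf{0}\\ \mathbf{Q}^\intercal&\mathbf{N}&\mathbf{R}\\ \mathbf{0}&\mathbf{R}^\intercal&\mathbf{M}\end{pmatrix},$$ where $\mathbf{Q}$ is the $|CV|\times|N(CV)|$ submatrix of $\mathbf{A}$ with rows indexed by $CV$ and columns indexed by $N(CV)$. Then $\dim\ker(\mathbf{Q}^\intercal)=\eta(G)$.
   Context: $\eta(G)=\dim\ker\mathbf{A}$ is the nullity of the $\{0,1\}$-adjacency matrix $\mathbf{A}$; $G$ is singular if $\eta(G)>0$. A vertex $v$ is a core vertex if some $\mathbf{x}\in\ker\mathbf{A}$ has $x_v\neq0$; $CV$ is the set of core vertices and the remaining vertices are core-forbidden. $N(CV)$ is the set of vertices adjacent to at least one core vertex, and $CFV_R=V\setminus(CV\cup N(CV))$ is the set of remote core-forbidden vertices. A graph with independent $CV$ labelled in this way is called core-labelled. -}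

module Defs where

open import Data.Nat using (ℕ; zero; suc; _+_)
open import Data.Fin using (Fin; _↑ˡ_; _↑ʳ_)
import Data.Fin as F
open import Data.Bool using (Bool; true; false; if_then_else_)
open import Data.Rational using (ℚ; 0ℚ; 1ℚ) renaming (_+_ to _+ℚ_; _*_ to _*ℚ_)
open import Data.Product using (Σ; ∃; _×_; _,_)
open import Relation.Binary.PropositionalEquality using (_≡_; _≢_)
open import Relation.Nullary using (¬_)

Matrix : ℕ → ℕ → Set
Matrix m k = Fin m → Fin k → ℚ

sumFin : (n : ℕ) → (Fin n → ℚ) → ℚ
sumFin zero    f = 0ℚ
sumFin (suc n) f = f F.zero +ℚ sumFin n (λ i → f (F.suc i))

InKer : {m k : ℕ} → Matrix m k → (Fin k → ℚ) → Set
InKer {m} {k} M x = ∀ (i : Fin m) → sumFin k (λ j → M i j *ℚ x j) ≡ 0ℚ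

LinIndep : {d k : ℕ} → (Fin d → Fin k → ℚ) → Set
LinIndep {d} {k} b =
  ∀ (c : Fin d → ℚ) →
  (∀ (j : Fin k) → sumFin d (λ i → c i *ℚ b i j) ≡ 0ℚ) →
  ∀ (i : Fin d) → c i ≡ 0ℚ

KerDim : {m k : ℕ} → Matrix m k → ℕ → Set
KerDim {m} {k} M d =
  (Σ (Fin d → Fin k → ℚ) λ b → (∀ i → InKer M (b i)) × LinIndep b)
  × (∀ (b : Fin (suc d) → Fin k → ℚ) → (∀ i → InKer M (b i)) → ¬ LinIndep b)

Symmetric : {n : ℕ} → (Fin n → Fin n → Bool) → Set
Symmetric adj = ∀ u v → adj u v ≡ adj v u

Loopless : {n : ℕ} → (Fin n → Fin n → Bool) → Set
Loopless adj = ∀ v → adj v v ≡ false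

adjMat : {n : ℕ} → (Fin n → Fin n → Bool) → Matrix n n
adjMat adj u v = if adj u v then 1ℚ else 0ℚ

IsCore : {n : ℕ} → (Fin n → Fin n → Bool) → Fin n → Set
IsCore adj v = Σ _ λ x → InKer (adjMat adj) x × (x v ≢ 0ℚ)

InNCV : {n : ℕ} → (Fin n → Fin n → Bool) → Fin n → Set
InNCV adj v = ∃ λ u → IsCore adj u × (adj u v ≡ true)

CoreIndependent : {n : ℕ} → (Fin n → Fin n → Bool) → Set
CoreIndependent adj = ∀ u v → IsCore adj u → IsCore adj v → adj u v ≡ false

cvIdx : {c d r : ℕ} → Fin c → Fin (c + d + r)
cvIdx {c} {d} {r} i = (i ↑ˡ d) ↑ˡ r

nIdx : {c d r : ℕ} → Fin d → Fin (c + d + r)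
nIdx {c} {d} {r} j = (c ↑ʳ j) ↑ˡ r

-- the labelling is core-labelled: the first c vertices are exactly CV,
-- the next d are exactly N(CV) (hence the last r are exactly CFV_R)
CoreLabelled : (c d r : ℕ) → (Fin (c + d + r) → Fin (c + d + r) → Bool) → Set
CoreLabelled c d r adj =
  (∀ v → IsCore adj v → ∃ λ i → v ≡ cvIdx {c} {d} {r} i)
  × (∀ i → IsCore adj (cvIdx {c} {d} {r} i))
  × (∀ v → InNCV adj v → ∃ λ j → v ≡ nIdx {c} {d} {r} j)
  × (∀ j → InNCV adj (nIdx {c} {d} {r} j))

Qmat : (c d r : ℕ) → (Fin (c + d + r) → Fin (c + d + r) → Bool) → Matrix c d
Qmat c d r adj i j = adjMat adj (cvIdx {c} {d} {r} i) (nIdx {c} {d} {r} j)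

transpose : {m k : ℕ} → Matrix m k → Matrix k m
transpose M j i = M i j

-- A kernel vector of A vanishes outside CV, by the very definition of core vertices, so
-- A x = 0 reduces to its N(CV)-rows, which read Qᵀ x_CV = 0.  Conversely, extending
-- y ∈ ker Qᵀ by zero gives a kernel vector of A: a row indexed by CV meets CV only in
-- zeros because CV is independent, and a row indexed by CFV_R does so because such a
-- vertex has no core neighbour.  Restriction to CV and extension by zero are thus
-- inverse isomorphisms between ker A and ker Qᵀ.
module Submission where

open import Defs
open import Data.Nat using (ℕ; _+_; _<_)
open import Data.Fin using (Fin)
open import Data.Bool using (Bool)

open import Data.Nat using (zero; suc)
open import Data.Fin using (zero; suc; _↑ˡ_; _↑ʳ_; splitAt; join)
open import Data.Fin.Properties using (↑ˡ-injective; splitAt-↑ˡ; splitAt-↑ʳ; join-splitAt)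
open import Data.Bool using (true; false; if_then_else_)
open import Data.Sum using (inj₁; inj₂; [_,_]′)
open import Data.Product using (∃; _×_; _,_; proj₁; proj₂)
open import Data.Empty using (⊥-elim)
open import Function using (_∘_; const)
open import Relation.Nullary using (yes; no)
open import Relation.Binary.PropositionalEquality
open import Data.Rational using (ℚ; 0ℚ; 1ℚ) renaming (_+_ to _+ℚ_; _*_ to _*ℚ_)
open import Data.Rational.Properties using (+-identityˡ; +-identityʳ; +-assoc; *-zeroˡ; *-zeroʳ; _≟_)

private
  variable
    m n k η : ℕ

sumFin-cong : ∀ n {f g : Fin n → ℚ} → (∀ i → f i ≡ g i) → sumFin n f ≡ sumFin n g
sumFin-cong zero    f≗g = refl
sumFin-cong (suc n) f≗g = cong₂ _+ℚ_ (f≗g zero) (sumFin-cong n (f≗g ∘ suc))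

sumFin-zero : ∀ n {f : Fin n → ℚ} → (∀ i → f i ≡ 0ℚ) → sumFin n f ≡ 0ℚ
sumFin-zero zero    f≗0 = refl
sumFin-zero (suc n) f≗0 =
  trans (cong₂ _+ℚ_ (f≗0 zero) (sumFin-zero n (f≗0 ∘ suc))) (+-identityˡ 0ℚ)

sumFin-++ : ∀ m n (f : Fin (m + n) → ℚ) →
            sumFin (m + n) f ≡ sumFin m (f ∘ (_↑ˡ n)) +ℚ sumFin n (f ∘ (m ↑ʳ_))
sumFin-++ zero    n f = sym (+-identityˡ _)
sumFin-++ (suc m) n f = begin
  f zero +ℚ sumFin (m + n) (f ∘ suc)
    ≡⟨ cong (f zero +ℚ_) (sumFin-++ m n (f ∘ suc)) ⟩
  f zero +ℚ (sumFin m (f ∘ suc ∘ (_↑ˡ n)) +ℚ sumFin n (f ∘ suc ∘ (m ↑ʳ_)))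
    ≡⟨ sym (+-assoc (f zero) _ _) ⟩
  (f zero +ℚ sumFin m (f ∘ suc ∘ (_↑ˡ n))) +ℚ sumFin n (f ∘ suc ∘ (m ↑ʳ_)) ∎
  where open ≡-Reasoning

sumFin-↑ˡ : ∀ m n {f : Fin (m + n) → ℚ} → (∀ j → f (m ↑ʳ j) ≡ 0ℚ) →
            sumFin (m + n) f ≡ sumFin m (f ∘ (_↑ˡ n))
sumFin-↑ˡ m n {f} f-right =
  trans (sumFin-++ m n f)
        (trans (cong (sumFin m (f ∘ (_↑ˡ n)) +ℚ_) (sumFin-zero n f-right)) (+-identityʳ _))

*-zeroʳ-cong : ∀ p {q : ℚ} → q ≡ 0ℚ → p *ℚ q ≡ 0ℚ
*-zeroʳ-cong p refl = *-zeroʳ p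

↑ˡ≢↑ʳ : ∀ {i : Fin m} {j : Fin n} → i ↑ˡ n ≢ m ↑ʳ j
↑ˡ≢↑ʳ {m} {n} {i} {j} eq
  with () ← trans (sym (splitAt-↑ˡ m i n)) (trans (cong (splitAt m) eq) (splitAt-↑ʳ m n j))

↑-elim : ∀ {ℓ} {P : Fin (m + n) → Set ℓ} →
         (∀ i → P (i ↑ˡ n)) → (∀ j → P (m ↑ʳ j)) → ∀ v → P v
↑-elim {m} {n} {P = P} left right v = subst P (join-splitAt m n v) (by-side (splitAt m v))
  where
  by-side : ∀ s → P (join m n s)
  by-side (inj₁ i) = left i
  by-side (inj₂ j) = right j

padʳ : (Fin m → ℚ) → Fin (m + n) → ℚ
padʳ {m} y = [ y , const 0ℚ ]′ ∘ splitAt m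

padʳ-↑ˡ : ∀ (y : Fin m → ℚ) i → padʳ y (i ↑ˡ n) ≡ y i
padʳ-↑ˡ {m} {n} y i = cong [ y , const 0ℚ ]′ (splitAt-↑ˡ m i n)

padʳ-↑ʳ : ∀ (y : Fin m → ℚ) j → padʳ {m} {n} y (m ↑ʳ j) ≡ 0ℚ
padʳ-↑ʳ {m} {n} y j = cong [ y , const 0ℚ ]′ (splitAt-↑ʳ m n j)

LinIndep-cong : {b b′ : Fin η → Fin k → ℚ} → (∀ i v → b i v ≡ b′ i v) →
                LinIndep b → LinIndep b′
LinIndep-cong {η} b≗b′ b-indep γ combination≡0 =
  b-indep γ (λ v → trans (sumFin-cong η (λ i → cong (γ i *ℚ_) (b≗b′ i v))) (combination≡0 v))

LinIndep-restriction⇒LinIndep : (b : Fin η → Fin k → ℚ) (σ : Fin m → Fin k) →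
                                LinIndep (λ i → b i ∘ σ) → LinIndep b
LinIndep-restriction⇒LinIndep b σ bσ-indep γ combination≡0 = bσ-indep γ (combination≡0 ∘ σ)

LinIndep-restrict-↑ˡ : (b : Fin η → Fin (m + n) → ℚ) → (∀ i j → b i (m ↑ʳ j) ≡ 0ℚ) →
                       LinIndep b → LinIndep (λ i → b i ∘ (_↑ˡ n))
LinIndep-restrict-↑ˡ {η} b b-right b-indep γ combination-left≡0 =
  b-indep γ (↑-elim combination-left≡0
    (λ j → sumFin-zero η (λ i → *-zeroʳ-cong (γ i) (b-right i j))))

adjMat-sym : ∀ {n} (adj : Fin n → Fin n → Bool) → Symmetric adj →
             ∀ u v → adjMat adj u v ≡ adjMat adj v u
adjMat-sym adj adj-sym u v = cong (λ b → if b then 1ℚ else 0ℚ) (adj-sym u v)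

adjMat-false : ∀ {n} (adj : Fin n → Fin n → Bool) {u v} →
               adj u v ≡ false → adjMat adj u v ≡ 0ℚ
adjMat-false adj adj[u,v]≡false = cong (λ b → if b then 1ℚ else 0ℚ) adj[u,v]≡false

module ThreeBlocks (c d r : ℕ) where

  cv : Fin c → Fin (c + d + r)
  cv = cvIdx {c} {d} {r}

  nv : Fin d → Fin (c + d + r)
  nv = nIdx {c} {d} {r}

  rv : Fin r → Fin (c + d + r)
  rv l = (c + d) ↑ʳ l

  cv≢nv : ∀ i j → cv i ≢ nv j
  cv≢nv i j = ↑ˡ≢↑ʳ ∘ ↑ˡ-injective r (i ↑ˡ d) (c ↑ʳ j)

  blocks-elim : ∀ {ℓ} {P : Fin (c + d + r) → Set ℓ} →
                (∀ i → P (cv i)) → (∀ j → P (nv j)) → (∀ l → P (rv l)) → ∀ v → P v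
  blocks-elim P-cv P-nv P-rv = ↑-elim (↑-elim P-cv P-nv) P-rv

  SupportedOnFirst : (Fin (c + d + r) → ℚ) → Set
  SupportedOnFirst x = (∀ j → x (nv j) ≡ 0ℚ) × (∀ l → x (rv l) ≡ 0ℚ)

  padFirst : (Fin c → ℚ) → Fin (c + d + r) → ℚ
  padFirst = padʳ ∘ padʳ

  padFirst-cv : ∀ y i → padFirst y (cv i) ≡ y i
  padFirst-cv y i = trans (padʳ-↑ˡ (padʳ y) (i ↑ˡ d)) (padʳ-↑ˡ y i)

  padFirst-supported : ∀ y → SupportedOnFirst (padFirst y)
  padFirst-supported y =
    (λ j → trans (padʳ-↑ˡ (padʳ y) (c ↑ʳ j)) (padʳ-↑ʳ y j)) , padʳ-↑ʳ (padʳ y)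

  sumFin-supportedOnFirst : ∀ (f x : Fin (c + d + r) → ℚ) → SupportedOnFirst x →
                            sumFin (c + d + r) (λ v → f v *ℚ x v)
                              ≡ sumFin c (λ i → f (cv i) *ℚ x (cv i))
  sumFin-supportedOnFirst f x (x-nv , x-rv) =
    trans (sumFin-↑ˡ (c + d) r (λ l → *-zeroʳ-cong (f (rv l)) (x-rv l)))
          (sumFin-↑ˡ c d (λ j → *-zeroʳ-cong (f (nv j)) (x-nv j)))

  LinIndep-restrictFirst : (b : Fin η → Fin (c + d + r) → ℚ) →
                           (∀ i → SupportedOnFirst (b i)) →
                           LinIndep b → LinIndep (λ i → b i ∘ cv)
  LinIndep-restrictFirst b b-supported =
    LinIndep-restrict-↑ˡ (λ i → b i ∘ (_↑ˡ r)) (λ i → proj₁ (b-supported i))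
    ∘ LinIndep-restrict-↑ˡ b (λ i → proj₂ (b-supported i))

  KerDim-restrictFirst : (M : Matrix m (c + d + r)) (M′ : Matrix n c) →
                         (∀ x → InKer M x → SupportedOnFirst x) →
                         (∀ x → InKer M x → InKer M′ (x ∘ cv)) →
                         (∀ y → InKer M′ y → InKer M (padFirst y)) →
                         KerDim M η → KerDim M′ η
  KerDim-restrictFirst M M′ supported restrict pad ((b , b-ker , b-indep) , b-maximal) =
    ( (λ i → b i ∘ cv)
    , (λ i → restrict (b i) (b-ker i))
    , LinIndep-restrictFirst b (λ i → supported (b i) (b-ker i)) b-indep )
    , λ b′ b′-ker b′-indep →
        b-maximal (padFirst ∘ b′) (λ i → pad (b′ i) (b′-ker i))
          (LinIndep-restriction⇒LinIndep (padFirst ∘ b′) cv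
            (LinIndep-cong (λ i v → sym (padFirst-cv (b′ i) v)) b′-indep))

module CoreLabelledGraph
  {c d r : ℕ} (adj : Fin (c + d + r) → Fin (c + d + r) → Bool)
  (adj-sym : Symmetric adj) (core-indep : CoreIndependent adj)
  (core⇒cv : ∀ v → IsCore adj v → ∃ λ i → v ≡ cvIdx {c} {d} {r} i)
  (cv-core : ∀ i → IsCore adj (cvIdx {c} {d} {r} i))
  (ncv⇒nv : ∀ v → InNCV adj v → ∃ λ j → v ≡ nIdx {c} {d} {r} j)
  where

  open ThreeBlocks c d r
  open ≡-Reasoning

  A : Matrix (c + d + r) (c + d + r)
  A = adjMat adj

  Qᵀ : Matrix d c
  Qᵀ = transpose (Qmat c d r adj)

  kernel-vanishes-off-cv : ∀ x → InKer A x → ∀ v → (∀ i → cv i ≢ v) → x v ≡ 0ℚ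
  kernel-vanishes-off-cv x x-ker v v∉cv with x v ≟ 0ℚ
  ... | yes x[v]≡0 = x[v]≡0
  ... | no x[v]≢0 with i , v≡cv ← core⇒cv v (x , x-ker , x[v]≢0) = ⊥-elim (v∉cv i (sym v≡cv))

  kernel-supportedOnFirst : ∀ x → InKer A x → SupportedOnFirst x
  kernel-supportedOnFirst x x-ker =
    (λ j → kernel-vanishes-off-cv x x-ker (nv j) (λ i → cv≢nv i j)) ,
    (λ l → kernel-vanishes-off-cv x x-ker (rv l) (λ i → ↑ˡ≢↑ʳ))

  rv-nonadjacent-cv : ∀ l i → adj (rv l) (cv i) ≡ false
  rv-nonadjacent-cv l i with adj (rv l) (cv i) in adj[rv,cv]
  ... | false = refl
  ... | true with j , rv≡nv ← ncv⇒nv (rv l) (cv i , cv-core i , trans (adj-sym _ _) adj[rv,cv])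
    = ⊥-elim (↑ˡ≢↑ʳ (sym rv≡nv))

  row-vanishes-on-cv : ∀ u → (∀ i → adj u (cv i) ≡ false) →
                       (y : Fin c → ℚ) → sumFin c (λ i → A u (cv i) *ℚ y i) ≡ 0ℚ
  row-vanishes-on-cv u u-nonadjacent y =
    sumFin-zero c (λ i → trans (cong (_*ℚ y i) (adjMat-false adj (u-nonadjacent i))) (*-zeroˡ (y i)))

  Qᵀ-row : ∀ j (y : Fin c → ℚ) →
           sumFin c (λ i → Qᵀ j i *ℚ y i) ≡ sumFin c (λ i → A (nv j) (cv i) *ℚ y i)
  Qᵀ-row j y = sumFin-cong c (λ i → cong (_*ℚ y i) (adjMat-sym adj adj-sym (cv i) (nv j)))

  restrict-kernel : ∀ x → InKer A x → InKer Qᵀ (x ∘ cv)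
  restrict-kernel x x-ker j = begin
    sumFin c (λ i → Qᵀ j i *ℚ x (cv i))           ≡⟨ Qᵀ-row j (x ∘ cv) ⟩
    sumFin c (λ i → A (nv j) (cv i) *ℚ x (cv i))
      ≡⟨ sym (sumFin-supportedOnFirst (A (nv j)) x (kernel-supportedOnFirst x x-ker)) ⟩
    sumFin (c + d + r) (λ v → A (nv j) v *ℚ x v)  ≡⟨ x-ker (nv j) ⟩
    0ℚ                                             ∎

  pad-kernel : ∀ y → InKer Qᵀ y → InKer A (padFirst y)
  pad-kernel y y-ker u = begin
    sumFin (c + d + r) (λ v → A u v *ℚ padFirst y v)
      ≡⟨ sumFin-supportedOnFirst (A u) (padFirst y) (padFirst-supported y) ⟩
    sumFin c (λ i → A u (cv i) *ℚ padFirst y (cv i))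
      ≡⟨ sumFin-cong c (λ i → cong (A u (cv i) *ℚ_) (padFirst-cv y i)) ⟩
    sumFin c (λ i → A u (cv i) *ℚ y i)
      ≡⟨ blocks-elim {P = λ u → sumFin c (λ i → A u (cv i) *ℚ y i) ≡ 0ℚ}
           (λ i′ → row-vanishes-on-cv (cv i′) (λ i → core-indep _ _ (cv-core i′) (cv-core i)) y)
           (λ j → trans (sym (Qᵀ-row j y)) (y-ker j))
           (λ l → row-vanishes-on-cv (rv l) (rv-nonadjacent-cv l) y)
           u ⟩
    0ℚ ∎

mainTheorem3 : (c d r : ℕ) (adj : Fin (c + d + r) → Fin (c + d + r) → Bool) →
    Symmetric adj → Loopless adj →
    CoreIndependent adj → CoreLabelled c d r adj →
    (η : ℕ) → KerDim (adjMat adj) η → 0 < η →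
    KerDim (transpose (Qmat c d r adj)) η
mainTheorem3 c d r adj adj-sym _ core-indep (core⇒cv , cv-core , ncv⇒nv , _) η A-kerDim _ =
  KerDim-restrictFirst A Qᵀ kernel-supportedOnFirst restrict-kernel pad-kernel A-kerDim
  where
  open ThreeBlocks c d r
  open CoreLabelledGraph adj adj-sym core-indep core⇒cv cv-core ncv⇒nv
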